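{- Let $(G',\sigma')$ be a signed graph with $W_{\sigma'}(G')=0$, and suppose there is a cycle $C'$ in $G'$ containing an edge $e$ such that $\sum_{e'\in E(C')}\sigma'(e')=-\sigma'(e)$. If $G$ is any graph obtained from $G'$ by replacing the edge $e=xy$ with an $xy$-path having an odd number of edges (whose internal vertices are new vertices), then $G$ is canceling.
   Context: A signed graph $(G,\sigma)$ is a graph $G$ with a signing $\sigma:E(G)\to\{\pm1\}$; for a path $P$, $\sigma(P)=\sum_{e\in P}\sigma(e)$; $d_\sigma(u,v)=\min_P|\sigma(P)|$ over all $uv$-paths $P$ in $G$ ($\infty$ if none exists, $0$ if $u=v$); $W_\sigma(G)=\frac12\sum_{u,v\in V(G)}d_\sigma(u,v)$. $G$ is canceling if some signing $\sigma$ has $W_\sigma(G)=0$. -}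

module Defs where

open import Data.Nat as ℕ using (ℕ; zero; suc; _≡ᵇ_; ⌊_/2⌋; _⊓_)
open import Data.Integer as ℤ using (ℤ; ∣_∣; -_)
open import Data.Fin using (Fin; _≟_; splitAt; toℕ)
open import Data.Bool using (Bool; true; false; _∧_; _∨_; not; if_then_else_)
open import Data.Sign using (Sign)
open import Data.Maybe using (Maybe; just; nothing)
open import Data.List using (List; []; _∷_; _++_; map; concatMap; filter; foldr; length; take; sum; allFin)
open import Data.List.Relation.Unary.Unique.Propositional using (Unique)
open import Data.List.Membership.Propositional using (_∈_)
open import Data.Product using (_×_; _,_; Σ; ∃)
open import Data.Sum using (_⊎_; inj₁; inj₂)
open import Relation.Nullary.Decidable using (⌊_⌋)
open import Relation.Binary.PropositionalEquality using (_≡_)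

-- Graphs: a (finite simple) graph on vertex set Fin n is given by a
-- Boolean adjacency relation; simplicity (symmetry, irreflexivity) is
-- imposed as a hypothesis where needed.

Graph : ℕ → Set
Graph n = Fin n → Fin n → Bool

IsSimple : ∀ {n} → Graph n → Set
IsSimple {n} G = (∀ u v → G u v ≡ G v u) × (∀ u → G u u ≡ false)

-- A signing assigns a sign to each (unordered) pair; only its values on
-- edges matter.  Symmetry is required so that σ is a function of edges.
Signing : ℕ → Set
Signing n = Fin n → Fin n → Sign

IsSymmetric : ∀ {n} → Signing n → Set
IsSymmetric {n} σ = ∀ u v → σ u v ≡ σ v u

sval : Sign → ℤ
sval Sign.+ = ℤ.+ 1
sval Sign.- = ℤ.-[1+ 0 ]

pairs : ∀ {n} → List (Fin n) → List (Fin n × Fin n)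
pairs (a ∷ b ∷ rest) = (a , b) ∷ pairs (b ∷ rest)
pairs _              = []

walkSign : ∀ {n} → Signing n → List (Fin n) → ℤ
walkSign σ vs = foldr (λ p acc → sval (σ (Data.Product.proj₁ p) (Data.Product.proj₂ p)) ℤ.+ acc) (ℤ.+ 0) (pairs vs)

_==_ : ∀ {n} → Fin n → Fin n → Bool
a == b = ⌊ a ≟ b ⌋

elem : ∀ {n} → Fin n → List (Fin n) → Bool
elem a []       = false
elem a (b ∷ bs) = (a == b) ∨ elem a bs

distinct : ∀ {n} → List (Fin n) → Bool
distinct []       = true
distinct (a ∷ as) = not (elem a as) ∧ distinct as

allAdj : ∀ {n} → Graph n → List (Fin n) → Bool
allAdj G vs = foldr (λ p acc → G (Data.Product.proj₁ p) (Data.Product.proj₂ p) ∧ acc) true (pairs vs)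

lastIs : ∀ {n} → Fin n → List (Fin n) → Bool
lastIs v []           = false
lastIs v (a ∷ [])     = a == v
lastIs v (a ∷ b ∷ bs) = lastIs v (b ∷ bs)

isPath : ∀ {n} → Graph n → Fin n → Fin n → List (Fin n) → Bool
isPath G u v []       = false
isPath G u v (a ∷ as) = (a == u) ∧ lastIs v (a ∷ as) ∧ allAdj G (a ∷ as) ∧ distinct (a ∷ as)

listsUpTo : ∀ {n} → ℕ → List (List (Fin n))
listsUpTo zero    = [] ∷ []
listsUpTo {n} (suc k) = [] ∷ concatMap (λ v → map (v ∷_) (listsUpTo k)) (allFin n)

-- all uv-paths of G (a path has at most n vertices)
paths : ∀ {n} → Graph n → Fin n → Fin n → List (List (Fin n))
paths {n} G u v = filter (λ P → isPath G u v P Data.Bool.≟ true) (listsUpTo n)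

-- ℕ ∪ {∞} as Maybe ℕ (nothing = ∞)

ℕ∞ : Set
ℕ∞ = Maybe ℕ

min∞ : ℕ∞ → ℕ∞ → ℕ∞
min∞ nothing  b        = b
min∞ (just a) nothing  = just a
min∞ (just a) (just b) = just (a ⊓ b)

_+∞_ : ℕ∞ → ℕ∞ → ℕ∞
just a +∞ just b = just (a ℕ.+ b)
_      +∞ _      = nothing

half∞ : ℕ∞ → ℕ∞
half∞ nothing  = nothing
half∞ (just a) = just ⌊ a /2⌋

dist : ∀ {n} → Graph n → Signing n → Fin n → Fin n → ℕ∞
dist G σ u v = foldr (λ P acc → min∞ (just ∣ walkSign σ P ∣) acc) nothing (paths G u v)

wiener : ∀ {n} → Graph n → Signing n → ℕ∞
wiener {n} G σ =
  half∞ (foldr _+∞_ (just 0)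
    (concatMap (λ u → map (λ v → dist G σ u v) (allFin n)) (allFin n)))

Canceling : ∀ {n} → Graph n → Set
Canceling {n} G = Σ (Signing n) λ σ → IsSymmetric σ × (wiener G σ ≡ just 0)

closeUp : ∀ {n} → List (Fin n) → List (Fin n)
closeUp vs = vs ++ take 1 vs

IsCycle : ∀ {n} → Graph n → List (Fin n) → Set
IsCycle G vs = (3 ℕ.≤ length vs) × Unique vs × (allAdj G (closeUp vs) ≡ true)

-- edge list E(C) of the cycle (each edge as an ordered pair)
cycleEdges : ∀ {n} → List (Fin n) → List (Fin n × Fin n)
cycleEdges vs = pairs (closeUp vs)

cycleSign : ∀ {n} → Signing n → List (Fin n) → ℤ
cycleSign σ vs = walkSign σ (closeUp vs)

-- Subdividing the edge xy of G' (on Fin n) into an xy-path with 2k+1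
-- edges, with 2k new internal vertices.  New vertex set Fin (n + 2k):
-- old vertices via inject+, new internal vertices via raise n.
-- The path is x = p₀, p₁ = new 0, …, p_{2k} = new (2k-1), p_{2k+1} = y.

module _ {n : ℕ} (G' : Graph n) (x y : Fin n) (k : ℕ) where

  pathPos : Fin (n ℕ.+ (2 ℕ.* k)) → Maybe ℕ
  pathPos w with splitAt n w
  ... | inj₁ a = if a == x then just 0 else (if a == y then just (suc (2 ℕ.* k)) else nothing)
  ... | inj₂ j = just (suc (toℕ j))

  pathAdj : Fin (n ℕ.+ (2 ℕ.* k)) → Fin (n ℕ.+ (2 ℕ.* k)) → Bool
  pathAdj u v with pathPos u | pathPos v
  ... | just i | just j = (suc i ≡ᵇ j) ∨ (suc j ≡ᵇ i)
  ... | _      | _      = false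

  isE : Fin n → Fin n → Bool
  isE a b = ((a == x) ∧ (b == y)) ∨ ((a == y) ∧ (b == x))

  oldAdj : Fin (n ℕ.+ (2 ℕ.* k)) → Fin (n ℕ.+ (2 ℕ.* k)) → Bool
  oldAdj u v with splitAt n u | splitAt n v
  ... | inj₁ a | inj₁ b = G' a b ∧ not (isE a b)
  ... | _      | _      = false

  subdivide : Graph (n ℕ.+ (2 ℕ.* k))
  subdivide u v = oldAdj u v ∨ pathAdj u v

-- Give the new xy-path p₀ = x, p₁, …, p_{2k+1} = y the alternating signs s, −s, s, …, s
-- where s = σ'(xy), and keep σ' elsewhere.  The path then has sign s, like the edge it
-- replaces, so every zero-sign path of G' lifts to one of G, and the partial sums
-- S_m = σ(p₀ ⋯ p_m) take only the values 0 and s.  An inner vertex p_m reaches the old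
-- graph with sign 0 through whichever end the partial sums allow; two inner vertices
-- p_i, p_j (i < j) with S_i ≠ S_j are joined by going out through x, across G', and
-- back in through y, using a zero-sign xy-path of G' avoiding xy (it exists as
-- d_σ'(x,y) = 0) when S_i = 0, and the rest of the cycle C', of sign −2s, when S_i = s.

module Submission where

open import Defs
open import Algebra using (AbelianGroup)
open import Data.Bool using (Bool; true; false; _∧_; _∨_; not; if_then_else_)
import Data.Bool.Properties as BoolP
open import Data.Empty using (⊥; ⊥-elim)
open import Data.Fin as Fin using (Fin; _≟_; splitAt; _↑ˡ_; _↑ʳ_)
import Data.Fin.Properties as FinP
open import Data.Integer as ℤ using (ℤ; -_; ∣_∣; 0ℤ)
open import Data.Integer.Tactic.RingSolver using (solve-∀)
import Data.Integer.Properties as ℤP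
open import Data.List
  using (List; []; _∷_; _++_; [_]; map; concatMap; foldr; length; reverse; allFin; initLast; _∷ʳ′_)
import Data.List.Properties as ListP
open import Data.List.Membership.Propositional using (_∈_; _∉_)
open import Data.List.Membership.Propositional.Properties
  using ( ∈-map⁺; ∈-map⁻; ∈-++⁺ˡ; ∈-++⁺ʳ; ∈-++⁻; ∈-∃++; ∈-filter⁺; ∈-filter⁻; ∈-allFin
        ; ∈-concatMap⁺; ∈-concatMap⁻)
open import Data.List.Relation.Binary.Disjoint.Propositional using (Disjoint)
open import Data.List.Relation.Binary.Permutation.Propositional using (_↭_; ↭⇒↭ₛ; ↭-sym)
open import Data.List.Relation.Binary.Permutation.Propositional.Properties using (↭-reverse; ++-comm)
import Data.List.Relation.Binary.Permutation.Setoid.Properties as PermutationSetoid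
open import Data.List.Relation.Unary.All as All using (All; []; _∷_)
open import Data.List.Relation.Unary.Any as Any using (here; there)
import Data.List.Relation.Unary.Any.Properties as AnyP
open import Data.List.Relation.Unary.AllPairs using ([]; _∷_)
open import Data.List.Relation.Unary.Unique.Propositional using (Unique)
import Data.List.Relation.Unary.Unique.Propositional.Properties as UniqueP
open import Data.Maybe using (Maybe; just; nothing)
open import Data.Maybe.Properties using (just-injective)
open import Data.Nat as ℕ using (ℕ; zero; suc; _⊓_; _≤_; _<_; _<?_; z≤n; s≤s)
import Data.Nat.Properties as ℕP
open import Data.Product using (_×_; _,_; ∃; ∃₂; proj₁; proj₂)
open import Data.Sign as Sign using (Sign)
import Data.Sign.Properties as SignP
open import Data.Sum using (_⊎_; inj₁; inj₂)
open import Function using (_∘_; Equivalence)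
open import Relation.Binary using (tri<; tri≈; tri>)
open import Relation.Binary.PropositionalEquality
  using (_≡_; _≢_; refl; sym; trans; cong; cong₂; subst; subst₂; setoid; module ≡-Reasoning)
open import Relation.Nullary using (¬_; Dec; yes; no)

open import Algebra.Properties.Group (AbelianGroup.group ℤP.+-0-abelianGroup) using (∙-cancelˡ)

∧-true : ∀ {a b} → a ∧ b ≡ true → a ≡ true × b ≡ true
∧-true {true} {true} refl = refl , refl

true-∧ : ∀ {a b} → a ≡ true → b ≡ true → a ∧ b ≡ true
true-∧ refl refl = refl

∨-true : ∀ {a b} → a ∨ b ≡ true → a ≡ true ⊎ b ≡ true
∨-true {true} _ = inj₁ refl
∨-true {false} e = inj₂ e

≡ᵇ-refl : ∀ m → (m ℕ.≡ᵇ m) ≡ true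
≡ᵇ-refl m = Equivalence.to BoolP.T-≡ (ℕP.≡⇒≡ᵇ m m refl)

module _ {N : ℕ} where

  ==-refl : (a : Fin N) → (a == a) ≡ true
  ==-refl a with a ≟ a
  ... | yes _ = refl
  ... | no a≢a = ⊥-elim (a≢a refl)

  ==⇒≡ : {a b : Fin N} → (a == b) ≡ true → a ≡ b
  ==⇒≡ {a} {b} e with a ≟ b
  ... | yes a≡b = a≡b

  ≢⇒==false : {a b : Fin N} → a ≢ b → (a == b) ≡ false
  ≢⇒==false {a} {b} a≢b with a ≟ b
  ... | yes a≡b = ⊥-elim (a≢b a≡b)
  ... | no _ = refl

  ∈⇒elem : ∀ {a : Fin N} {as} → a ∈ as → elem a as ≡ true
  ∈⇒elem {a} (here refl) rewrite ==-refl a = refl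
  ∈⇒elem {a} {b ∷ _} (there a∈as) with a == b
  ... | true = refl
  ... | false = ∈⇒elem a∈as

  ∉⇒elem : ∀ {a : Fin N} {as} → a ∉ as → elem a as ≡ false
  ∉⇒elem {as = []} _ = refl
  ∉⇒elem {a} {b ∷ bs} a∉ with a ≟ b
  ... | yes a≡b = ⊥-elim (a∉ (here a≡b))
  ... | no _ = ∉⇒elem (λ m → a∉ (there m))

  distinct⇒Unique : (as : List (Fin N)) → distinct as ≡ true → Unique as
  distinct⇒Unique [] _ = []
  distinct⇒Unique (a ∷ as) e with ∧-true {not (elem a as)} e
  ... | a∉ , as-distinct = All.tabulate a≢ ∷ distinct⇒Unique as as-distinct
    where
    a≢ : ∀ {b} → b ∈ as → a ≢ b
    a≢ b∈as refl with () ← trans (sym (BoolP.not-injective a∉)) (∈⇒elem b∈as)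

  Unique⇒distinct : (as : List (Fin N)) → Unique as → distinct as ≡ true
  Unique⇒distinct [] _ = refl
  Unique⇒distinct (a ∷ as) (a∉ ∷ u)
    rewrite ∉⇒elem {a} {as} (λ m → All.lookup a∉ m refl) = Unique⇒distinct as u

module _ {X : Set} where

  Unique-resp-↭ : ∀ {xs ys : List X} → xs ↭ ys → Unique xs → Unique ys
  Unique-resp-↭ p = PermutationSetoid.Unique-resp-↭ (setoid X) (↭⇒↭ₛ p)

  Unique-reverse : ∀ {xs : List X} → Unique xs → Unique (reverse xs)
  Unique-reverse {xs} = Unique-resp-↭ (↭-sym (↭-reverse xs))

  Unique-++-comm : ∀ (xs : List X) {ys} → Unique (xs ++ ys) → Unique (ys ++ xs)
  Unique-++-comm xs {ys} = Unique-resp-↭ (++-comm xs ys)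

  Unique-tail : ∀ {a : X} {xs} → Unique (a ∷ xs) → Unique xs
  Unique-tail (_ ∷ u) = u

  Unique-head : ∀ {a : X} {xs} → Unique (a ∷ xs) → All (a ≢_) xs
  Unique-head (a∉ ∷ _) = a∉

  Unique⇒length≤ : ∀ {xs ys : List X} → Unique xs → (∀ {v} → v ∈ xs → v ∈ ys) → length xs ≤ length ys
  Unique⇒length≤ {[]} _ _ = z≤n
  Unique⇒length≤ {x ∷ xs} {ys} (x∉ ∷ u) xs⊆ys with ∈-∃++ (xs⊆ys (here refl))
  ... | ys₁ , ys₂ , refl =
    ℕP.≤-trans (s≤s (Unique⇒length≤ u xs⊆ys₁++ys₂))
               (ℕP.≤-reflexive (sym (ListP.length-++-sucʳ ys₁ x ys₂)))
    where
    xs⊆ys₁++ys₂ : ∀ {v} → v ∈ xs → v ∈ ys₁ ++ ys₂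
    xs⊆ys₁++ys₂ m with ∈-++⁻ ys₁ (xs⊆ys (there m))
    ... | inj₁ m₁ = ∈-++⁺ˡ m₁
    ... | inj₂ (here refl) = ⊥-elim (All.lookup x∉ m refl)
    ... | inj₂ (there m₂) = ∈-++⁺ʳ ys₁ m₂

data Walk {N} (H : Graph N) : Fin N → Fin N → List (Fin N) → Set where
  here : ∀ u → Walk H u u [ u ]
  step : ∀ {u w v ws} → H u w ≡ true → Walk H w v (w ∷ ws) → Walk H u v (u ∷ w ∷ ws)

module _ {N} {H : Graph N} where

  walk-++ : ∀ {u v w P Q} → Walk H u v P → Walk H v w (v ∷ Q) → Walk H u w (P ++ Q)
  walk-++ (here _) W = W
  walk-++ (step h W) W' = step h (walk-++ W W')

  walk-head : ∀ {u v P} → Walk H u v P → ∃ λ Q → P ≡ u ∷ Q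
  walk-head (here _) = [] , refl
  walk-head (step {w = w} {ws = ws} _ _) = w ∷ ws , refl

  walk-start : ∀ {u v a P} → Walk H u v (a ∷ P) → u ≡ a
  walk-start (here _) = refl
  walk-start (step _ _) = refl

  end∈walk : ∀ {u v P} → Walk H u v P → v ∈ P
  end∈walk (here _) = here refl
  end∈walk (step _ W) = there (end∈walk W)

  walk-split : ∀ P {u v a Q} → Walk H u v (P ++ a ∷ Q) → Walk H u a (P ++ [ a ]) × Walk H a v (a ∷ Q)
  walk-split [] W with walk-start W
  ... | refl = here _ , W
  walk-split (_ ∷ []) (step h W) = step h (here _) , W
  walk-split (_ ∷ b ∷ P) (step h W) with walk-split (b ∷ P) W
  ... | W₁ , W₂ = step h W₁ , W₂

  closed-walk-Unique : ∀ {u P} → Walk H u u (u ∷ P) → Unique (u ∷ P) → P ≡ []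
  closed-walk-Unique (here _) _ = refl
  closed-walk-Unique (step _ W) (u∉ ∷ _) = ⊥-elim (All.lookup u∉ (end∈walk W) refl)

  walk⇒allAdj : ∀ {u v P} → Walk H u v P → allAdj H P ≡ true
  walk⇒allAdj (here _) = refl
  walk⇒allAdj (step h W) = true-∧ h (walk⇒allAdj W)

  walk⇒lastIs : ∀ {u v P} → Walk H u v P → lastIs v P ≡ true
  walk⇒lastIs (here u) = ==-refl u
  walk⇒lastIs (step _ W) = walk⇒lastIs W

  allAdj⇒walk : ∀ {v} a P → lastIs v (a ∷ P) ≡ true → allAdj H (a ∷ P) ≡ true → Walk H a v (a ∷ P)
  allAdj⇒walk a [] last _ with ==⇒≡ last
  ... | refl = here a
  allAdj⇒walk a (b ∷ P) last adj with ∧-true {H a b} adj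
  ... | h , adj′ = step h (allAdj⇒walk b P last adj′)

  walk⇒isPath : ∀ {u v P} → Walk H u v P → Unique P → isPath H u v P ≡ true
  walk⇒isPath {u} {P = P} W u-P with walk-head W
  ... | _ , refl =
    true-∧ (==-refl u) (true-∧ (walk⇒lastIs W) (true-∧ (walk⇒allAdj W) (Unique⇒distinct P u-P)))

  isPath⇒walk : ∀ {u v} P → isPath H u v P ≡ true → Walk H u v P × Unique P
  isPath⇒walk (a ∷ P) e with ∧-true {a == _} e
  ... | start , e₁ with ∧-true {lastIs _ (a ∷ P)} e₁
  ... | last , e₂ with ∧-true {allAdj H (a ∷ P)} e₂
  ... | adj , dist with ==⇒≡ start
  ... | refl = allAdj⇒walk a P last adj , distinct⇒Unique (a ∷ P) dist

  walkSign-++ : ∀ (τ : Signing N) {u v P} Q → Walk H u v P →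
                walkSign τ (P ++ Q) ≡ walkSign τ P ℤ.+ walkSign τ (v ∷ Q)
  walkSign-++ τ Q (here _) = sym (ℤP.+-identityˡ _)
  walkSign-++ τ Q (step {u} {w} _ W) =
    trans (cong (λ z → sval (τ u w) ℤ.+ z) (walkSign-++ τ Q W)) (sym (ℤP.+-assoc (sval (τ u w)) _ _))

  module _ (H-sym : ∀ u v → H u v ≡ H v u) where

    walk-reverse : ∀ {u v P} → Walk H u v P → Walk H v u (reverse P)
    walk-reverse (here u) = here u
    walk-reverse {u} (step {w = w} {ws = ws} h W) rewrite ListP.unfold-reverse u (w ∷ ws) =
      walk-++ (walk-reverse W) (step (trans (H-sym w u) h) (here u))

    walkSign-reverse : ∀ (τ : Signing N) → IsSymmetric τ → ∀ {u v P} → Walk H u v P →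
                       walkSign τ (reverse P) ≡ walkSign τ P
    walkSign-reverse τ τ-sym (here u) = refl
    walkSign-reverse τ τ-sym {u} (step {w = w} {ws = ws} h W) rewrite ListP.unfold-reverse u (w ∷ ws) =
      begin
        walkSign τ (reverse (w ∷ ws) ++ [ u ])
      ≡⟨ walkSign-++ τ [ u ] (walk-reverse W) ⟩
        walkSign τ (reverse (w ∷ ws)) ℤ.+ (sval (τ w u) ℤ.+ 0ℤ)
      ≡⟨ cong₂ ℤ._+_ (walkSign-reverse τ τ-sym W) (trans (ℤP.+-identityʳ _) (cong sval (τ-sym w u))) ⟩
        walkSign τ (w ∷ ws) ℤ.+ sval (τ u w)
      ≡⟨ ℤP.+-comm _ (sval (τ u w)) ⟩
        walkSign τ (u ∷ w ∷ ws)
      ∎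
      where open ≡-Reasoning

ZeroPath : ∀ {N} → Graph N → Signing N → Fin N → Fin N → Set
ZeroPath H τ u v = ∃ λ P → Walk H u v P × Unique P × walkSign τ P ≡ 0ℤ

listsUpTo-complete : ∀ {N} k (P : List (Fin N)) → length P ≤ k → P ∈ listsUpTo k
listsUpTo-complete zero [] _ = here refl
listsUpTo-complete (suc k) [] _ = here refl
listsUpTo-complete {N} (suc k) (v ∷ P) (s≤s l) =
  there (∈-concatMap⁺ (λ w → map (w ∷_) (listsUpTo k))
          (Any.map (λ { refl → ∈-map⁺ (v ∷_) (listsUpTo-complete k P l) }) (∈-allFin v)))

-- dist H τ u v is definitionally minimum (∣_∣ ∘ walkSign τ) (paths H u v).
module _ {X : Set} (g : X → ℕ) where

  minimum : List X → ℕ∞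
  minimum = foldr (λ P acc → min∞ (just (g P)) acc) nothing

  minimum≡0 : ∀ {L P} → P ∈ L → g P ≡ 0 → minimum L ≡ just 0
  minimum≡0 {P ∷ L} (here refl) gP≡0 rewrite gP≡0 with minimum L
  ... | nothing = refl
  ... | just _ = refl
  minimum≡0 {Q ∷ L} (there P∈L) gP≡0 rewrite minimum≡0 P∈L gP≡0 = cong just (ℕP.⊓-zeroʳ (g Q))

  minimum≡0⁻ : ∀ L → minimum L ≡ just 0 → ∃ λ P → P ∈ L × g P ≡ 0
  minimum≡0⁻ (P ∷ L) e with minimum L in eq | g P in gP
  ... | nothing | _ = P , here refl , trans gP (just-injective e)
  ... | just _ | zero = P , here refl , gP
  ... | just zero | suc _ with minimum≡0⁻ L eq
  ...   | Q , Q∈L , gQ≡0 = Q , there Q∈L , gQ≡0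

module _ {N} (H : Graph N) (τ : Signing N) where

  zeroPath⇒dist≡0 : ∀ {u v} → ZeroPath H τ u v → dist H τ u v ≡ just 0
  zeroPath⇒dist≡0 {u} {v} (P , W , u-P , σP≡0) =
    minimum≡0 (λ P → ∣ walkSign τ P ∣) P∈paths (cong ∣_∣ σP≡0)
    where
    length≤N : length P ≤ N
    length≤N = ℕP.≤-trans (Unique⇒length≤ u-P (λ {w} _ → ∈-allFin w))
                          (ℕP.≤-reflexive (ListP.length-tabulate (λ i → i)))
    P∈paths : P ∈ paths H u v
    P∈paths = ∈-filter⁺ (λ P → isPath H u v P Data.Bool.≟ true)
                        (listsUpTo-complete N P length≤N) (walk⇒isPath W u-P)

  dist≡0⇒zeroPath : ∀ {u v} → dist H τ u v ≡ just 0 → ZeroPath H τ u v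
  dist≡0⇒zeroPath {u} {v} e with minimum≡0⁻ (λ P → ∣ walkSign τ P ∣) (paths H u v) e
  ... | P , P∈paths , ∣σP∣≡0
    with ∈-filter⁻ (λ P → isPath H u v P Data.Bool.≟ true) {xs = listsUpTo N} P∈paths
  ... | _ , path with isPath⇒walk P path
  ... | W , u-P = P , W , u-P , ℤP.∣i∣≡0⇒i≡0 ∣σP∣≡0

  ZeroPath-refl : ∀ u → ZeroPath H τ u u
  ZeroPath-refl u = [ u ] , here u , [] ∷ [] , refl

  ZeroPath-sym : (∀ u v → H u v ≡ H v u) → IsSymmetric τ → ∀ {u v} → ZeroPath H τ u v → ZeroPath H τ v u
  ZeroPath-sym H-sym τ-sym (P , W , u-P , σP≡0) =
    reverse P , walk-reverse H-sym W , Unique-reverse u-P , trans (walkSign-reverse H-sym τ τ-sym W) σP≡0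

infix 4 _≼_
_≼_ : ℕ → ℕ∞ → Set
m ≼ z = ∀ {t} → z ≡ just t → m ≤ t

0≼ : ∀ z → 0 ≼ z
0≼ _ _ = z≤n

≢just0⇒1≼ : ∀ z → z ≢ just 0 → 1 ≼ z
≢just0⇒1≼ z z≢0 {zero} e = ⊥-elim (z≢0 e)
≢just0⇒1≼ z z≢0 {suc _} e = s≤s z≤n

≼-+∞ : ∀ {a b} z w → a ≼ z → b ≼ w → a ℕ.+ b ≼ z +∞ w
≼-+∞ (just z) (just w) a≼z b≼w refl = ℕP.+-mono-≤ (a≼z refl) (b≼w refl)
≼-+∞ (just _) nothing _ _ ()
≼-+∞ nothing _ _ _ ()

≡just0? : ∀ z → Dec (z ≡ just 0)
≡just0? nothing = no λ ()
≡just0? (just zero) = yes refl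
≡just0? (just (suc _)) = no λ ()

2≼⇒half∞≢0 : ∀ z → 2 ≼ z → half∞ z ≢ just 0
2≼⇒half∞≢0 (just (suc (suc _))) _ ()
2≼⇒half∞≢0 (just 0) 2≼z _ with () ← 2≼z refl
2≼⇒half∞≢0 (just 1) 2≼z _ with s≤s () ← 2≼z refl

sum∞ : List ℕ∞ → ℕ∞
sum∞ = foldr _+∞_ (just 0)

+∞-assoc : ∀ a b c → (a +∞ b) +∞ c ≡ a +∞ (b +∞ c)
+∞-assoc (just a) (just b) (just c) = cong just (ℕP.+-assoc a b c)
+∞-assoc (just _) (just _) nothing = refl
+∞-assoc (just _) nothing _ = refl
+∞-assoc nothing _ _ = refl

+∞-identityˡ : ∀ z → just 0 +∞ z ≡ z
+∞-identityˡ (just _) = refl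
+∞-identityˡ nothing = refl

sum∞-++ : ∀ A B → sum∞ (A ++ B) ≡ sum∞ A +∞ sum∞ B
sum∞-++ [] B = sym (+∞-identityˡ (sum∞ B))
sum∞-++ (a ∷ A) B = trans (cong (a +∞_) (sum∞-++ A B)) (sym (+∞-assoc a (sum∞ A) (sum∞ B)))

sum∞-concatMap : ∀ {X : Set} (f : X → List ℕ∞) L → sum∞ (concatMap f L) ≡ sum∞ (map (λ u → sum∞ (f u)) L)
sum∞-concatMap f [] = refl
sum∞-concatMap f (u ∷ L) = trans (sum∞-++ (f u) (concatMap f L)) (cong (sum∞ (f u) +∞_) (sum∞-concatMap f L))

sum∞-all0 : ∀ L → All (_≡ just 0) L → sum∞ L ≡ just 0
sum∞-all0 [] _ = refl
sum∞-all0 (_ ∷ L) (refl ∷ all0) rewrite sum∞-all0 L all0 = refl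

≼-sum∞ : ∀ {m z} L → z ∈ L → m ≼ z → m ≼ sum∞ L
≼-sum∞ {m} (a ∷ L) (here refl) m≼a = subst (_≼ _) (ℕP.+-identityʳ m) (≼-+∞ a (sum∞ L) m≼a (0≼ _))
≼-sum∞ (a ∷ L) (there z∈L) m≼z = ≼-+∞ a (sum∞ L) (0≼ a) (≼-sum∞ L z∈L m≼z)

2≼-sum∞-map : ∀ {X : Set} (f : X → ℕ∞) L {u v} → u ∈ L → v ∈ L → u ≢ v → 1 ≼ f u → 1 ≼ f v →
              2 ≼ sum∞ (map f L)
2≼-sum∞-map f (a ∷ L) (here refl) (here refl) u≢v _ _ = ⊥-elim (u≢v refl)
2≼-sum∞-map f (a ∷ L) (here refl) (there v∈L) _ 1≼fu 1≼fv =
  ≼-+∞ (f a) _ 1≼fu (≼-sum∞ (map f L) (∈-map⁺ f v∈L) 1≼fv)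
2≼-sum∞-map f (a ∷ L) (there u∈L) (here refl) _ 1≼fu 1≼fv =
  ≼-+∞ (f a) _ 1≼fv (≼-sum∞ (map f L) (∈-map⁺ f u∈L) 1≼fu)
2≼-sum∞-map f (a ∷ L) (there u∈L) (there v∈L) u≢v 1≼fu 1≼fv =
  ≼-+∞ (f a) _ (0≼ (f a)) (2≼-sum∞-map f L u∈L v∈L u≢v 1≼fu 1≼fv)

module _ {N} (H : Graph N) (τ : Signing N) where

  private
    row : Fin N → List ℕ∞
    row u = map (dist H τ u) (allFin N)

  dist≡0⇒wiener≡0 : (∀ u v → dist H τ u v ≡ just 0) → wiener H τ ≡ just 0
  dist≡0⇒wiener≡0 all0 = cong half∞ (sum∞-all0 _ (All.tabulate entry≡0))
    where
    entry≡0 : ∀ {z} → z ∈ concatMap row (allFin N) → z ≡ just 0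
    entry≡0 z∈ with Any.satisfied (∈-concatMap⁻ row {xs = allFin N} z∈)
    ... | u , z∈row with ∈-map⁻ (dist H τ u) z∈row
    ... | v , _ , refl = all0 u v

  -- Halving the double sum only hides a total of 1; but d(u,v) ≠ 0 forces d(v,u) ≠ 0 and u ≠ v.
  wiener≡0⇒dist≡0 : (∀ u v → H u v ≡ H v u) → IsSymmetric τ → wiener H τ ≡ just 0 →
                    ∀ u v → dist H τ u v ≡ just 0
  wiener≡0⇒dist≡0 H-sym τ-sym W≡0 u v with ≡just0? (dist H τ u v) | ≡just0? (dist H τ v u) | u ≟ v
  ... | yes duv≡0 | _ | _ = duv≡0
  ... | no duv≢0 | yes dvu≡0 | _ =
    ⊥-elim (duv≢0 (zeroPath⇒dist≡0 H τ (ZeroPath-sym H τ H-sym τ-sym (dist≡0⇒zeroPath H τ dvu≡0))))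
  ... | no duv≢0 | no _ | yes refl = ⊥-elim (duv≢0 (zeroPath⇒dist≡0 H τ (ZeroPath-refl H τ u)))
  ... | no duv≢0 | no dvu≢0 | no u≢v = ⊥-elim (2≼⇒half∞≢0 _ total≥2 W≡0)
    where
    row≥1 : ∀ {a b} → dist H τ a b ≢ just 0 → 1 ≼ sum∞ (row a)
    row≥1 {a} {b} d≢0 = ≼-sum∞ (row a) (∈-map⁺ (dist H τ a) (∈-allFin b)) (≢just0⇒1≼ _ d≢0)
    total≥2 : 2 ≼ sum∞ (concatMap row (allFin N))
    total≥2 = subst (2 ≼_) (sym (sum∞-concatMap row (allFin N)))
                (2≼-sum∞-map (λ a → sum∞ (row a)) (allFin N) (∈-allFin u) (∈-allFin v) u≢v
                             (row≥1 duv≢0) (row≥1 dvu≢0))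

pairs-split : ∀ {N} {a b : Fin N} c L → (a , b) ∈ pairs (c ∷ L) →
              ∃₂ λ Z₁ Z₂ → c ∷ L ≡ Z₁ ++ a ∷ b ∷ Z₂
pairs-split c (d ∷ L) (here refl) = [] , L , refl
pairs-split c (d ∷ L) (there ab∈) with pairs-split d L ab∈
... | Z₁ , Z₂ , e = c ∷ Z₁ , Z₂ , cong (c ∷_) e

lastIs-∷ʳ : ∀ {N} (v : Fin N) L → lastIs v (L ++ [ v ]) ≡ true
lastIs-∷ʳ v [] = ==-refl v
lastIs-∷ʳ v (_ ∷ []) = ==-refl v
lastIs-∷ʳ v (_ ∷ b ∷ L) = lastIs-∷ʳ v (b ∷ L)

module _ {N} {G : Graph N} (σ : Signing N) where

  cycle-minus-edge : ∀ C → IsCycle G C → ∀ {a b} → (a , b) ∈ cycleEdges C →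
    ∃ λ Q → Walk G b a Q × Unique Q × length Q ≡ length C × walkSign σ Q ℤ.+ sval (σ a b) ≡ cycleSign σ C
  cycle-minus-edge (v₀ ∷ rest) (_ , u-C , adj) {a} {b} ab∈ with pairs-split v₀ (rest ++ [ v₀ ]) ab∈
  ... | Z₁ , Z₂ , eq with initLast Z₂
  ... | [] with ListP.∷ʳ-injective (v₀ ∷ rest) (Z₁ ++ [ a ]) (trans eq (sym (ListP.++-assoc Z₁ [ a ] [ b ])))
  ...   | C≡ , refl = v₀ ∷ rest , subst (Walk G b a) (sym C≡) W₁ , u-C , refl , sign
    where
    W₁ : Walk G b a (Z₁ ++ [ a ])
    W₁ = proj₁ (walk-split Z₁ (subst (Walk G b b) eq (allAdj⇒walk b (rest ++ [ b ]) (lastIs-∷ʳ b (b ∷ rest)) adj)))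
    open ≡-Reasoning
    sign : walkSign σ (v₀ ∷ rest) ℤ.+ sval (σ a b) ≡ cycleSign σ (v₀ ∷ rest)
    sign = begin
      walkSign σ (v₀ ∷ rest) ℤ.+ sval (σ a b)
        ≡⟨ cong (λ P → walkSign σ P ℤ.+ sval (σ a b)) C≡ ⟩
      walkSign σ (Z₁ ++ [ a ]) ℤ.+ sval (σ a b)
        ≡⟨ cong (λ z → walkSign σ (Z₁ ++ [ a ]) ℤ.+ z) (ℤP.+-identityʳ _) ⟨
      walkSign σ (Z₁ ++ [ a ]) ℤ.+ walkSign σ (a ∷ [ b ])
        ≡⟨ walkSign-++ σ [ b ] W₁ ⟨
      walkSign σ ((Z₁ ++ [ a ]) ++ [ b ])
        ≡⟨ cong (walkSign σ) (ListP.++-assoc Z₁ [ a ] [ b ]) ⟩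
      walkSign σ (Z₁ ++ a ∷ [ b ])
        ≡⟨ cong (walkSign σ) eq ⟨
      cycleSign σ (v₀ ∷ rest)
        ∎
  cycle-minus-edge (v₀ ∷ rest) (_ , u-C , adj) {a} {b} ab∈ | Z₁ , _ , eq | Z₂ ∷ʳ′ z
    with ListP.∷ʳ-injective (v₀ ∷ rest) (Z₁ ++ a ∷ b ∷ Z₂)
           (trans eq (sym (ListP.++-assoc Z₁ (a ∷ b ∷ Z₂) [ z ])))
  ... | C≡ , refl
    with walk-split Z₁ (subst (Walk G v₀ v₀) eq
                          (allAdj⇒walk v₀ (rest ++ [ v₀ ]) (lastIs-∷ʳ v₀ (v₀ ∷ rest)) adj))
  ... | W₁ , step _ W₂ with walk-head W₁
  ... | Y , Z₁a≡ = Q , walk-++ W₂ (subst (Walk G v₀ a) Z₁a≡ W₁) , u-Q , length-Q , sign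
    where
    Q = (b ∷ Z₂ ++ [ v₀ ]) ++ Y
    Q≡ : Q ≡ (b ∷ Z₂) ++ (Z₁ ++ [ a ])
    Q≡ = trans (cong (b ∷_) (ListP.++-assoc Z₂ [ v₀ ] Y)) (cong (λ t → b ∷ Z₂ ++ t) (sym Z₁a≡))
    C≡′ : v₀ ∷ rest ≡ (Z₁ ++ [ a ]) ++ (b ∷ Z₂)
    C≡′ = trans C≡ (sym (ListP.++-assoc Z₁ [ a ] (b ∷ Z₂)))
    u-Q : Unique Q
    u-Q = subst Unique (sym Q≡) (Unique-++-comm (Z₁ ++ [ a ]) (subst Unique C≡′ u-C))
    length-Q : length Q ≡ length (v₀ ∷ rest)
    length-Q = trans (cong length Q≡) (trans (ListP.length-++-comm (b ∷ Z₂) (Z₁ ++ [ a ])) (cong length (sym C≡′)))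
    open ≡-Reasoning
    sign : walkSign σ Q ℤ.+ sval (σ a b) ≡ cycleSign σ (v₀ ∷ rest)
    sign = begin
      walkSign σ Q ℤ.+ sval (σ a b)
        ≡⟨ cong (ℤ._+ sval (σ a b)) (walkSign-++ σ Y W₂) ⟩
      walkSign σ (b ∷ Z₂ ++ [ v₀ ]) ℤ.+ walkSign σ (v₀ ∷ Y) ℤ.+ sval (σ a b)
        ≡⟨ rotate (walkSign σ (b ∷ Z₂ ++ [ v₀ ])) (walkSign σ (v₀ ∷ Y)) (sval (σ a b)) ⟩
      walkSign σ (v₀ ∷ Y) ℤ.+ walkSign σ (a ∷ b ∷ Z₂ ++ [ v₀ ])
        ≡⟨ cong (λ P → walkSign σ P ℤ.+ walkSign σ (a ∷ b ∷ Z₂ ++ [ v₀ ])) Z₁a≡ ⟨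
      walkSign σ (Z₁ ++ [ a ]) ℤ.+ walkSign σ (a ∷ b ∷ Z₂ ++ [ v₀ ])
        ≡⟨ walkSign-++ σ (b ∷ Z₂ ++ [ v₀ ]) W₁ ⟨
      walkSign σ ((Z₁ ++ [ a ]) ++ b ∷ Z₂ ++ [ v₀ ])
        ≡⟨ cong (walkSign σ) (trans (ListP.++-assoc Z₁ [ a ] _) (sym eq)) ⟩
      cycleSign σ (v₀ ∷ rest)
        ∎
      where
      rotate : ∀ B A c → B ℤ.+ A ℤ.+ c ≡ A ℤ.+ (c ℤ.+ B)
      rotate = solve-∀

-- The subdivided graph

module Subdivision {n} (G' : Graph n) (σ' : Signing n) (G'-simple : IsSimple G') (σ'-sym : IsSymmetric σ')
                   (x y : Fin n) (xy∈G' : G' x y ≡ true) (k : ℕ) where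

  K N : ℕ
  K = 2 ℕ.* k
  N = n ℕ.+ K

  G : Graph N
  G = subdivide G' x y k

  old : Fin n → Fin N
  old a = a ↑ˡ K

  new : Fin K → Fin N
  new j = n ↑ʳ j

  old-or-new : ∀ w → (∃ λ a → w ≡ old a) ⊎ (∃ λ j → w ≡ new j)
  old-or-new w with splitAt n w in e
  ... | inj₁ a = inj₁ (a , sym (FinP.splitAt⁻¹-↑ˡ e))
  ... | inj₂ j = inj₂ (j , sym (FinP.splitAt⁻¹-↑ʳ e))

  old-injective : ∀ {a b} → old a ≡ old b → a ≡ b
  old-injective = FinP.↑ˡ-injective K _ _

  IsNew : Fin N → Set
  IsNew w = ∃ λ j → w ≡ new j

  old-not-new : ∀ {a} → ¬ IsNew (old a)
  old-not-new {a} (j , e) with trans (sym (FinP.splitAt-↑ˡ n a K)) (trans (cong (splitAt n) e) (FinP.splitAt-↑ʳ n K j))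
  ... | ()

  x≢y : x ≢ y
  x≢y refl with () ← trans (sym xy∈G') (proj₂ G'-simple x)

  -- p 0 = x, p 1, …, p (K + 1) = y are the vertices of the new path (p is junk beyond K + 1).
  p : ℕ → Fin N
  p zero = old x
  p (suc m) with m <? K
  ... | yes m<K = new (Fin.fromℕ< m<K)
  ... | no _ = old y

  p-new : ∀ m (m<K : m < K) → p (suc m) ≡ new (Fin.fromℕ< m<K)
  p-new m m<K with m <? K
  ... | yes _ = refl
  ... | no m≮K = ⊥-elim (m≮K m<K)

  p-last : p (suc K) ≡ old y
  p-last with K <? K
  ... | yes K<K = ⊥-elim (ℕP.<-irrefl refl K<K)
  ... | no _ = refl

  new≡p : ∀ j → new j ≡ p (suc (Fin.toℕ j))
  new≡p j = sym (trans (p-new (Fin.toℕ j) (FinP.toℕ<n j)) (cong new (FinP.fromℕ<-toℕ j (FinP.toℕ<n j))))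

  p-inner-new : ∀ m → 1 ≤ m → m ≤ K → IsNew (p m)
  p-inner-new (suc m) _ m<K = Fin.fromℕ< m<K , p-new m m<K

  pos : Fin N → Maybe ℕ
  pos = pathPos G' x y k

  pos-x : pos (old x) ≡ just 0
  pos-x rewrite FinP.splitAt-↑ˡ n x K | ==-refl x = refl

  pos-y : pos (old y) ≡ just (suc K)
  pos-y rewrite FinP.splitAt-↑ˡ n y K | ≢⇒==false (x≢y ∘ sym) | ==-refl y = refl

  pos-new : ∀ j → pos (new j) ≡ just (suc (Fin.toℕ j))
  pos-new j rewrite FinP.splitAt-↑ʳ n K j = refl

  pos-old : ∀ a i → pos (old a) ≡ just i → (a ≡ x × i ≡ 0) ⊎ (a ≡ y × i ≡ suc K)
  pos-old a i e rewrite FinP.splitAt-↑ˡ n a K with a == x in a==x | a == y in a==y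
  ... | true | _ = inj₁ (==⇒≡ a==x , sym (just-injective e))
  ... | false | true = inj₂ (==⇒≡ a==y , sym (just-injective e))

  pos-p : ∀ m → m ≤ suc K → pos (p m) ≡ just m
  pos-p zero _ = pos-x
  pos-p (suc m) m≤K with m <? K
  ... | yes m<K = trans (pos-new (Fin.fromℕ< m<K)) (cong (just ∘ suc) (FinP.toℕ-fromℕ< m<K))
  ... | no m≮K = trans pos-y (cong (just ∘ suc) (ℕP.≤-antisym (ℕP.≮⇒≥ m≮K) (ℕ.s≤s⁻¹ m≤K)))

  p-injective : ∀ {i j} → i ≤ suc K → j ≤ suc K → p i ≡ p j → i ≡ j
  p-injective {i} {j} i≤ j≤ e = just-injective (trans (sym (pos-p i i≤)) (trans (cong pos e) (pos-p j j≤)))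

  isXY : Fin n → Fin n → Bool
  isXY = isE G' x y k

  isXY-sym : ∀ a b → isXY a b ≡ isXY b a
  isXY-sym a b rewrite BoolP.∧-comm (a == x) (b == y) | BoolP.∧-comm (a == y) (b == x) =
    BoolP.∨-comm (b == y ∧ a == x) (b == x ∧ a == y)

  isXY⇒ : ∀ {a b} → isXY a b ≡ true → (a ≡ x × b ≡ y) ⊎ (a ≡ y × b ≡ x)
  isXY⇒ {a} {b} e with ∨-true {(a == x) ∧ (b == y)} e
  ... | inj₁ e′ = inj₁ (Data.Product.map ==⇒≡ ==⇒≡ (∧-true {a == x} e′))
  ... | inj₂ e′ = inj₂ (Data.Product.map ==⇒≡ ==⇒≡ (∧-true {a == y} e′))

  G-sym : ∀ u v → G u v ≡ G v u
  G-sym u v = cong₂ _∨_ oldAdj-sym pathAdj-sym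
    where
    oldAdj-sym : oldAdj G' x y k u v ≡ oldAdj G' x y k v u
    oldAdj-sym with splitAt n u | splitAt n v
    ... | inj₁ a | inj₁ b rewrite proj₁ G'-simple a b | isXY-sym a b = refl
    ... | inj₁ _ | inj₂ _ = refl
    ... | inj₂ _ | inj₁ _ = refl
    ... | inj₂ _ | inj₂ _ = refl
    pathAdj-sym : pathAdj G' x y k u v ≡ pathAdj G' x y k v u
    pathAdj-sym with pos u | pos v
    ... | just i | just j = BoolP.∨-comm (suc i ℕ.≡ᵇ j) (suc j ℕ.≡ᵇ i)
    ... | just _ | nothing = refl
    ... | nothing | just _ = refl
    ... | nothing | nothing = refl

  G-path-edge : ∀ m → m ≤ K → G (p m) (p (suc m)) ≡ true
  G-path-edge m m≤K with oldAdj G' x y k (p m) (p (suc m))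
  ... | b rewrite pos-p m (ℕP.m≤n⇒m≤1+n m≤K) | pos-p (suc m) (s≤s m≤K) | ≡ᵇ-refl m = BoolP.∨-zeroʳ b

  G-old-edge : ∀ a b → G' a b ≡ true → isXY a b ≡ false → G (old a) (old b) ≡ true
  G-old-edge a b ab∈G' ab≢xy rewrite FinP.splitAt-↑ˡ n a K | FinP.splitAt-↑ˡ n b K | ab∈G' | ab≢xy = refl

  s : Sign
  s = σ' x y

  pathSign : ℕ → Sign
  pathSign zero = s
  pathSign (suc m) = Sign.opposite (pathSign m)

  -- The second clause only concerns pairs that are not edges of G.
  signBetween : Maybe ℕ → Maybe ℕ → Sign
  signBetween (just i) (just j) = pathSign (i ⊓ j)
  signBetween _ _ = Sign.+

  τ : Signing N
  τ u v with splitAt n u | splitAt n v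
  ... | inj₁ a | inj₁ b = σ' a b
  ... | _ | _ = signBetween (pos u) (pos v)

  signBetween-sym : ∀ i j → signBetween i j ≡ signBetween j i
  signBetween-sym (just i) (just j) = cong pathSign (ℕP.⊓-comm i j)
  signBetween-sym (just _) nothing = refl
  signBetween-sym nothing (just _) = refl
  signBetween-sym nothing nothing = refl

  τ-sym : IsSymmetric τ
  τ-sym u v with splitAt n u | splitAt n v
  ... | inj₁ a | inj₁ b = σ'-sym a b
  ... | inj₁ _ | inj₂ _ = signBetween-sym (pos u) (pos v)
  ... | inj₂ _ | inj₁ _ = signBetween-sym (pos u) (pos v)
  ... | inj₂ _ | inj₂ _ = signBetween-sym (pos u) (pos v)

  τ-old : ∀ a b → τ (old a) (old b) ≡ σ' a b
  τ-old a b rewrite FinP.splitAt-↑ˡ n a K | FinP.splitAt-↑ˡ n b K = refl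

  τ-new : ∀ j v → τ (new j) v ≡ signBetween (pos (new j)) (pos v)
  τ-new j v = trans (unfold v) (cong (λ i → signBetween i (pos v)) (sym (pos-new j)))
    where
    unfold : ∀ v → τ (new j) v ≡ signBetween (just (suc (Fin.toℕ j))) (pos v)
    unfold v rewrite FinP.splitAt-↑ʳ n K j with splitAt n v
    ... | inj₁ _ = cong (λ i → signBetween i _) (pos-new j)
    ... | inj₂ _ = cong (λ i → signBetween i _) (pos-new j)

  τ-path : ∀ u v {i j} → pos u ≡ just i → pos v ≡ just j → i ≢ j → τ u v ≡ pathSign (i ⊓ j)
  τ-path u v {i} {j} pos-u pos-v i≢j with old-or-new u | old-or-new v
  ... | inj₂ (j′ , refl) | _ = trans (τ-new j′ v) (cong₂ signBetween pos-u pos-v)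
  ... | inj₁ (a , refl) | inj₂ (j′ , refl) =
    trans (τ-sym (old a) (new j′))
      (trans (τ-new j′ (old a)) (trans (cong₂ signBetween pos-v pos-u) (cong pathSign (ℕP.⊓-comm j i))))
  ... | inj₁ (a , refl) | inj₁ (b , refl) with pos-old a i pos-u | pos-old b j pos-v
  ...   | inj₁ (refl , refl) | inj₁ (refl , refl) = ⊥-elim (i≢j refl)
  ...   | inj₁ (refl , refl) | inj₂ (refl , refl) = τ-old x y
  ...   | inj₂ (refl , refl) | inj₁ (refl , refl) = trans (τ-old y x) (σ'-sym y x)
  ...   | inj₂ (refl , refl) | inj₂ (refl , refl) = ⊥-elim (i≢j refl)

  τ-path-edge : ∀ m → m ≤ K → τ (p m) (p (suc m)) ≡ pathSign m
  τ-path-edge m m≤K =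
    trans (τ-path _ _ (pos-p m (ℕP.m≤n⇒m≤1+n m≤K)) (pos-p (suc m) (s≤s m≤K)) (ℕP.<⇒≢ (ℕP.n<1+n m)))
          (cong pathSign (ℕP.m≤n⇒m⊓n≡m (ℕP.n≤1+n m)))

  S : ℕ → ℤ
  S zero = 0ℤ
  S (suc m) = S m ℤ.+ sval (pathSign m)

  sval-opposite : ∀ t → sval t ℤ.+ sval (Sign.opposite t) ≡ 0ℤ
  sval-opposite Sign.+ = refl
  sval-opposite Sign.- = refl

  S-values : ∀ m → (S m ≡ 0ℤ × pathSign m ≡ s) ⊎ (S m ≡ sval s × pathSign m ≡ Sign.opposite s)
  S-values zero = inj₁ (refl , refl)
  S-values (suc m) with S-values m
  ... | inj₁ (Sm≡0 , pm≡s) =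
    inj₂ (trans (cong₂ ℤ._+_ Sm≡0 (cong sval pm≡s)) (ℤP.+-identityˡ _) , cong Sign.opposite pm≡s)
  ... | inj₂ (Sm≡s , pm≡-s) =
    inj₁ ( trans (cong₂ ℤ._+_ Sm≡s (cong sval pm≡-s)) (sval-opposite s)
         , trans (cong Sign.opposite pm≡-s) (SignP.opposite-involutive s))

  S-+2 : ∀ m → S (suc (suc m)) ≡ S m
  S-+2 m = begin
    S m ℤ.+ sval t ℤ.+ sval (Sign.opposite t)   ≡⟨ ℤP.+-assoc (S m) _ _ ⟩
    S m ℤ.+ (sval t ℤ.+ sval (Sign.opposite t)) ≡⟨ cong (λ z → S m ℤ.+ z) (sval-opposite t) ⟩
    S m ℤ.+ 0ℤ                                  ≡⟨ ℤP.+-identityʳ (S m) ⟩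
    S m                                         ∎
    where
    t = pathSign m
    open ≡-Reasoning

  S-even : ∀ q → S (2 ℕ.* q) ≡ 0ℤ × pathSign (2 ℕ.* q) ≡ s
  S-even zero = refl , refl
  S-even (suc q) with S-even q
  ... | S≡0 , pathSign≡s =
    subst (λ m → S m ≡ 0ℤ × pathSign m ≡ s) (sym (ℕP.*-suc 2 q))
      (trans (S-+2 (2 ℕ.* q)) S≡0 , trans (SignP.opposite-involutive _) pathSign≡s)

  S-last : S (suc K) ≡ sval s
  S-last with S-even k
  ... | S≡0 , pathSign≡s = trans (cong₂ ℤ._+_ S≡0 (cong sval pathSign≡s)) (ℤP.+-identityˡ _)

  segment : ℕ → ℕ → List (Fin N)
  segment i zero = []
  segment i (suc d) = p i ∷ segment (suc i) d

  segment-walk : ∀ i d → i ℕ.+ d ≤ suc K → Walk G (p i) (p (i ℕ.+ d)) (segment i (suc d))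
  segment-walk i zero _ rewrite ℕP.+-identityʳ i = here (p i)
  segment-walk i (suc d) i+d<K+2 rewrite ℕP.+-suc i d =
    step (G-path-edge i (ℕ.s≤s⁻¹ (ℕP.≤-trans (s≤s (ℕP.m≤m+n i d)) i+d<K+2))) (segment-walk (suc i) d i+d<K+2)

  segment-sign : ∀ i d → i ℕ.+ d ≤ suc K → S i ℤ.+ walkSign τ (segment i (suc d)) ≡ S (i ℕ.+ d)
  segment-sign i zero _ rewrite ℕP.+-identityʳ i = ℤP.+-identityʳ (S i)
  segment-sign i (suc d) i+d<K+2 rewrite ℕP.+-suc i d =
    trans (sym (ℤP.+-assoc (S i) _ _))
      (trans (cong (λ t → S i ℤ.+ sval t ℤ.+ walkSign τ (segment (suc i) (suc d)))
                   (τ-path-edge i (ℕ.s≤s⁻¹ (ℕP.≤-trans (s≤s (ℕP.m≤m+n i d)) i+d<K+2))))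
             (segment-sign (suc i) d i+d<K+2))

  ∈-segment : ∀ i d {w} → w ∈ segment i d → ∃ λ m → i ≤ m × m < i ℕ.+ d × w ≡ p m
  ∈-segment i (suc d) (here refl) = i , ℕP.≤-refl , ℕP.m<m+n i (s≤s z≤n) , refl
  ∈-segment i (suc d) (there w∈) with ∈-segment (suc i) d w∈
  ... | m , i<m , m<i+d , refl = m , ℕP.<⇒≤ i<m , ℕP.≤-trans m<i+d (ℕP.≤-reflexive (sym (ℕP.+-suc i d))) , refl

  segment-Unique : ∀ i d → i ℕ.+ d ≤ suc (suc K) → Unique (segment i d)
  segment-Unique i zero _ = []
  segment-Unique i (suc d) i+d≤ = All.tabulate p-i∉ ∷ segment-Unique (suc i) d i+d≤′
    where
    i+d≤′ : suc i ℕ.+ d ≤ suc (suc K)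
    i+d≤′ = ℕP.≤-trans (ℕP.≤-reflexive (sym (ℕP.+-suc i d))) i+d≤
    p-i∉ : ∀ {w} → w ∈ segment (suc i) d → p i ≢ w
    p-i∉ w∈ e with ∈-segment (suc i) d w∈
    ... | m , i<m , m<i+d , refl =
      ℕP.<⇒≢ i<m (p-injective (ℕ.s≤s⁻¹ (ℕP.≤-trans (s≤s (ℕP.m≤m+n i d)) i+d≤′))
                               (ℕ.s≤s⁻¹ (ℕP.≤-trans m<i+d i+d≤′)) e)

  segment-∷ʳ : ∀ i d → segment i (suc d) ≡ segment i d ++ [ p (i ℕ.+ d) ]
  segment-∷ʳ i zero rewrite ℕP.+-identityʳ i = refl
  segment-∷ʳ i (suc d) rewrite ℕP.+-suc i d = cong (p i ∷_) (segment-∷ʳ (suc i) d)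

  inner : List (Fin N)
  inner = segment 1 K

  ∈-inner : ∀ {w} → w ∈ inner → IsNew w
  ∈-inner w∈ with ∈-segment 1 K w∈
  ... | m , 1≤m , m<K+1 , refl = p-inner-new m 1≤m (ℕ.s≤s⁻¹ m<K+1)

  xToY yToX : List (Fin N)
  xToY = old x ∷ inner ++ [ old y ]
  yToX = old y ∷ reverse inner ++ [ old x ]

  segment-0-whole : segment 0 (suc (suc K)) ≡ xToY
  segment-0-whole = cong (old x ∷_) (trans (segment-∷ʳ 1 K) (cong (λ v → inner ++ [ v ]) p-last))

  reverse-xToY : reverse xToY ≡ yToX
  reverse-xToY = begin
    reverse (old x ∷ inner ++ [ old y ])        ≡⟨ ListP.unfold-reverse (old x) (inner ++ [ old y ]) ⟩
    reverse (inner ++ [ old y ]) ++ [ old x ]   ≡⟨ cong (_++ [ old x ]) (ListP.reverse-++ inner [ old y ]) ⟩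
    yToX                                        ∎
    where open ≡-Reasoning

  xToY-walk : Walk G (old x) (old y) xToY
  xToY-walk = subst₂ (Walk G (old x)) p-last segment-0-whole (segment-walk 0 (suc K) ℕP.≤-refl)

  xToY-sign : walkSign τ xToY ≡ sval s
  xToY-sign = begin
    walkSign τ xToY                                   ≡⟨ cong (walkSign τ) segment-0-whole ⟨
    walkSign τ (segment 0 (suc (suc K)))              ≡⟨ ℤP.+-identityˡ _ ⟨
    S 0 ℤ.+ walkSign τ (segment 0 (suc (suc K)))      ≡⟨ segment-sign 0 (suc K) ℕP.≤-refl ⟩
    S (suc K)                                         ≡⟨ S-last ⟩
    sval s                                            ∎
    where open ≡-Reasoning

  yToX-walk : Walk G (old y) (old x) yToX
  yToX-walk = subst (Walk G (old y) (old x)) reverse-xToY (walk-reverse G-sym xToY-walk)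

  yToX-sign : walkSign τ yToX ≡ sval s
  yToX-sign = trans (cong (walkSign τ) (sym reverse-xToY)) (trans (walkSign-reverse G-sym τ τ-sym xToY-walk) xToY-sign)

  -- Lifting paths of G'

  -- The vertices that follow old a when the edge ab of G' is traced in G.
  liftEdge : Fin n → Fin n → List (Fin N)
  liftEdge a b = if isXY a b then (if a == x then inner ++ [ old y ] else reverse inner ++ [ old x ]) else [ old b ]

  data LiftEdgeView (a b : Fin n) : Set where
    other : isXY a b ≡ false → liftEdge a b ≡ [ old b ] → LiftEdgeView a b
    xy : isXY a b ≡ true → a ≡ x → b ≡ y → old a ∷ liftEdge a b ≡ xToY → LiftEdgeView a b
    yx : isXY a b ≡ true → a ≡ y → b ≡ x → old a ∷ liftEdge a b ≡ yToX → LiftEdgeView a b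

  liftEdge-view : ∀ a b → LiftEdgeView a b
  liftEdge-view a b with isXY a b in e
  ... | false = other e (cong (λ c → if c then _ else [ old b ]) e)
  ... | true with isXY⇒ {a} {b} e
  ...   | inj₁ (refl , refl) = xy e refl refl xy-lifts
    where
    xy-lifts : old x ∷ liftEdge x y ≡ xToY
    xy-lifts rewrite e | ==-refl x = refl
  ...   | inj₂ (refl , refl) = yx e refl refl yx-lifts
    where
    yx-lifts : old y ∷ liftEdge y x ≡ yToX
    yx-lifts rewrite e | ≢⇒==false (x≢y ∘ sym) = refl

  xToY-Unique : Unique xToY
  xToY-Unique = subst Unique segment-0-whole (segment-Unique 0 (suc (suc K)) ℕP.≤-refl)

  yToX-Unique : Unique yToX
  yToX-Unique = subst Unique reverse-xToY (Unique-reverse xToY-Unique)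

  liftEdge-walk : ∀ a b → G' a b ≡ true → Walk G (old a) (old b) (old a ∷ liftEdge a b)
  liftEdge-walk a b ab∈G' with liftEdge-view a b
  ... | other ab≢xy eq rewrite eq = step (G-old-edge a b ab∈G' ab≢xy) (here (old b))
  ... | xy _ refl refl eq = subst (Walk G (old x) (old y)) (sym eq) xToY-walk
  ... | yx _ refl refl eq = subst (Walk G (old y) (old x)) (sym eq) yToX-walk

  liftEdge-sign : ∀ a b → walkSign τ (old a ∷ liftEdge a b) ≡ sval (σ' a b)
  liftEdge-sign a b with liftEdge-view a b
  ... | other _ eq rewrite eq = trans (ℤP.+-identityʳ _) (cong sval (τ-old a b))
  ... | xy _ refl refl eq = trans (cong (walkSign τ) eq) xToY-sign
  ... | yx _ refl refl eq = trans (cong (walkSign τ) eq) (trans yToX-sign (cong sval (σ'-sym x y)))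

  liftEdge-Unique : ∀ a b → Unique (liftEdge a b)
  liftEdge-Unique a b with liftEdge-view a b
  ... | other _ eq rewrite eq = [] ∷ []
  ... | xy _ refl refl eq = Unique-tail (subst Unique (sym eq) xToY-Unique)
  ... | yx _ refl refl eq = Unique-tail (subst Unique (sym eq) yToX-Unique)

  ∈-liftEdge : ∀ a b {w} → w ∈ liftEdge a b → w ≡ old b ⊎ (isXY a b ≡ true × IsNew w)
  ∈-liftEdge a b w∈ with liftEdge-view a b
  ... | other _ eq with subst (_ ∈_) eq w∈
  ...   | here refl = inj₁ refl
  ∈-liftEdge a b w∈ | xy e refl refl eq with ∈-++⁻ inner (subst (_ ∈_) (ListP.∷-injectiveʳ eq) w∈)
  ...   | inj₁ w∈inner = inj₂ (e , ∈-inner w∈inner)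
  ...   | inj₂ (here refl) = inj₁ refl
  ∈-liftEdge a b w∈ | yx e refl refl eq with ∈-++⁻ (reverse inner) (subst (_ ∈_) (ListP.∷-injectiveʳ eq) w∈)
  ...   | inj₁ w∈inner = inj₂ (e , ∈-inner (AnyP.reverse⁻ w∈inner))
  ...   | inj₂ (here refl) = inj₁ refl

  liftTail : Fin n → List (Fin n) → List (Fin N)
  liftTail a [] = []
  liftTail a (b ∷ r) = liftEdge a b ++ liftTail b r

  lift-walk : ∀ {a v r} → Walk G' a v (a ∷ r) → Walk G (old a) (old v) (old a ∷ liftTail a r)
  lift-walk (here a) = here (old a)
  lift-walk (step {u = a} {w = b} ab∈G' W) = walk-++ (liftEdge-walk a b ab∈G') (lift-walk W)

  lift-sign : ∀ {a v r} → Walk G' a v (a ∷ r) → walkSign τ (old a ∷ liftTail a r) ≡ walkSign σ' (a ∷ r)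
  lift-sign (here a) = refl
  lift-sign (step {u = a} {w = b} {ws = r} ab∈G' W) =
    trans (walkSign-++ τ (liftTail b r) (liftEdge-walk a b ab∈G')) (cong₂ ℤ._+_ (liftEdge-sign a b) (lift-sign W))

  usesXY : List (Fin n) → Bool
  usesXY (a ∷ b ∷ r) = isXY a b ∨ usesXY (b ∷ r)
  usesXY _ = false

  usesXY⇒ : ∀ a r → usesXY (a ∷ r) ≡ true → x ∈ a ∷ r × y ∈ a ∷ r
  usesXY⇒ a (b ∷ r) e with ∨-true {isXY a b} e
  ... | inj₂ uses = Data.Product.map there there (usesXY⇒ b r uses)
  ... | inj₁ ab≡xy with isXY⇒ {a} {b} ab≡xy
  ...   | inj₁ (refl , refl) = here refl , there (here refl)
  ...   | inj₂ (refl , refl) = there (here refl) , here refl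

  ∈-liftTail : ∀ a r {w} → w ∈ liftTail a r →
               (∃ λ c → c ∈ r × w ≡ old c) ⊎ (IsNew w × usesXY (a ∷ r) ≡ true)
  ∈-liftTail a (b ∷ r) w∈ with ∈-++⁻ (liftEdge a b) w∈
  ... | inj₁ w∈edge with ∈-liftEdge a b w∈edge
  ...   | inj₁ refl = inj₁ (b , here refl , refl)
  ...   | inj₂ (ab≡xy , w-new) rewrite ab≡xy = inj₂ (w-new , refl)
  ∈-liftTail a (b ∷ r) w∈ | inj₂ w∈tail with ∈-liftTail b r w∈tail
  ...   | inj₁ (c , c∈r , refl) = inj₁ (c , there c∈r , refl)
  ...   | inj₂ (w-new , uses) rewrite uses = inj₂ (w-new , BoolP.∨-zeroʳ (isXY a b))

  lift-Unique : ∀ a r → Unique (a ∷ r) → Unique (old a ∷ liftTail a r)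
  lift-Unique a [] _ = [] ∷ []
  lift-Unique a (b ∷ r) (a∉ ∷ u-br) with lift-Unique b r u-br
  ... | _ ∷ u-tail = All.tabulate old-a∉ ∷ UniqueP.++⁺ (liftEdge-Unique a b) u-tail disjoint
    where
    b∉r : All (b ≢_) r
    b∉r = Unique-head u-br
    -- If both parts meet in a new vertex, both ab and b ∷ r use the edge xy, so a ∈ {x, y} ⊆ b ∷ r.
    disjoint : Disjoint (liftEdge a b) (liftTail b r)
    disjoint (w∈edge , w∈tail) with ∈-liftEdge a b w∈edge | ∈-liftTail b r w∈tail
    ... | inj₁ refl | inj₁ (c , c∈r , e) = All.lookup b∉r c∈r (old-injective e)
    ... | inj₁ refl | inj₂ (w-new , _) = old-not-new w-new
    ... | inj₂ (_ , w-new) | inj₁ (c , c∈r , refl) = old-not-new w-new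
    ... | inj₂ (ab≡xy , _) | inj₂ (_ , uses) with usesXY⇒ b r uses | isXY⇒ {a} {b} ab≡xy
    ...   | x∈ , _ | inj₁ (refl , _) = All.lookup a∉ x∈ refl
    ...   | _ , y∈ | inj₂ (refl , _) = All.lookup a∉ y∈ refl
    old-a∉ : ∀ {w} → w ∈ liftEdge a b ++ liftTail b r → old a ≢ w
    old-a∉ w∈ refl with ∈-++⁻ (liftEdge a b) w∈
    ... | inj₁ w∈edge with ∈-liftEdge a b w∈edge
    ...   | inj₁ e = All.lookup a∉ (here refl) (old-injective e)
    ...   | inj₂ (_ , w-new) = old-not-new w-new
    old-a∉ w∈ refl | inj₂ w∈tail with ∈-liftTail b r w∈tail
    ...   | inj₁ (c , c∈r , e) = All.lookup a∉ (there c∈r) (old-injective e)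
    ...   | inj₂ (w-new , _) = old-not-new w-new

  ∉⇒¬usesXY : ∀ {c} → c ≡ x ⊎ c ≡ y → ∀ a r → c ∉ a ∷ r → usesXY (a ∷ r) ≡ false
  ∉⇒¬usesXY c-end a r c∉ with usesXY (a ∷ r) in uses
  ... | false = refl
  ... | true with usesXY⇒ a r uses | c-end
  ...   | x∈ , _ | inj₁ refl = ⊥-elim (c∉ x∈)
  ...   | _ , y∈ | inj₂ refl = ⊥-elim (c∉ y∈)

  usesXY-from-end : ∀ {c c′ v r} → (c ≡ x × c′ ≡ y) ⊎ (c ≡ y × c′ ≡ x) →
    Walk G' c v (c ∷ r) → Unique (c ∷ r) → usesXY (c ∷ r) ≡ true →
    ∃ λ r′ → r ≡ c′ ∷ r′ × usesXY (c′ ∷ r′) ≡ false ×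
             Walk G' c′ v (c′ ∷ r′) × Unique (c′ ∷ r′)
  usesXY-from-end {c} ends (step {w = w} {ws = r} _ W) u-cr uses with isXY c w in cw
  ... | false
    with () ← trans (sym uses) (∉⇒¬usesXY (Data.Sum.map proj₁ proj₁ ends) w r (UniqueP.Unique[x∷xs]⇒x∉xs u-cr))
  ... | true with isXY⇒ {c} {w} cw | ends
  ...   | inj₁ (refl , refl) | inj₁ (_ , refl) =
    r , refl , ∉⇒¬usesXY (inj₁ refl) y r (UniqueP.Unique[x∷xs]⇒x∉xs u-cr) , W , Unique-tail u-cr
  ...   | inj₂ (refl , refl) | inj₂ (_ , refl) =
    r , refl , ∉⇒¬usesXY (inj₂ refl) x r (UniqueP.Unique[x∷xs]⇒x∉xs u-cr) , W , Unique-tail u-cr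
  ...   | inj₁ (refl , _) | inj₂ (x≡y , _) = ⊥-elim (x≢y x≡y)
  ...   | inj₂ (refl , _) | inj₁ (y≡x , _) = ⊥-elim (x≢y (sym y≡x))

  toX toY : ℕ → List (Fin N)
  toX m = reverse (segment 0 (suc m))
  toY m = segment m (suc (suc K ℕ.∸ m))

  toX-walk : ∀ m → m ≤ suc K → Walk G (p m) (old x) (toX m)
  toX-walk m m≤ = walk-reverse G-sym (segment-walk 0 m m≤)

  toX-Unique : ∀ m → m ≤ suc K → Unique (toX m)
  toX-Unique m m≤ = Unique-reverse (segment-Unique 0 (suc m) (s≤s m≤))

  toX-sign : ∀ m → m ≤ suc K → walkSign τ (toX m) ≡ S m
  toX-sign m m≤ = trans (walkSign-reverse G-sym τ τ-sym (segment-walk 0 m m≤))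
                        (trans (sym (ℤP.+-identityˡ _)) (segment-sign 0 m m≤))

  ∈-toX : ∀ m → m ≤ K → ∀ {w} → w ∈ toX m → w ≡ old x ⊎ IsNew w
  ∈-toX m m≤K w∈ with ∈-segment 0 (suc m) (AnyP.reverse⁻ w∈)
  ... | zero , _ , _ , e = inj₁ e
  ... | suc l , _ , l<m+1 , refl = inj₂ (p-inner-new (suc l) (s≤s z≤n) (ℕP.≤-trans (ℕ.s≤s⁻¹ l<m+1) m≤K))

  m+[K+1∸m] : ∀ m → m ≤ suc K → m ℕ.+ (suc K ℕ.∸ m) ≡ suc K
  m+[K+1∸m] m = ℕP.m+[n∸m]≡n

  toY-walk : ∀ m → m ≤ suc K → Walk G (p m) (old y) (toY m)
  toY-walk m m≤ = subst (λ v → Walk G (p m) v (toY m)) (trans (cong p (m+[K+1∸m] m m≤)) p-last)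
                        (segment-walk m (suc K ℕ.∸ m) (ℕP.≤-reflexive (m+[K+1∸m] m m≤)))

  m+[K+2∸m] : ∀ m → m ≤ suc K → m ℕ.+ suc (suc K ℕ.∸ m) ≡ suc (suc K)
  m+[K+2∸m] m m≤ = trans (ℕP.+-suc m _) (cong suc (m+[K+1∸m] m m≤))

  toY-Unique : ∀ m → m ≤ suc K → Unique (toY m)
  toY-Unique m m≤ = segment-Unique m _ (ℕP.≤-reflexive (m+[K+2∸m] m m≤))

  toY-sign : ∀ m → m ≤ suc K → walkSign τ (toY m) ≡ sval s ℤ.- S m
  toY-sign m m≤ = begin
    walkSign τ (toY m)                  ≡⟨ cancel (S m) _ ⟨
    S m ℤ.+ walkSign τ (toY m) ℤ.- S m  ≡⟨ cong (ℤ._- S m) (segment-sign m _ (ℕP.≤-reflexive m+[K+1∸m]≡)) ⟩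
    S (m ℕ.+ (suc K ℕ.∸ m)) ℤ.- S m     ≡⟨ cong (λ l → S l ℤ.- S m) (m+[K+1∸m] m m≤) ⟩
    S (suc K) ℤ.- S m                   ≡⟨ cong (ℤ._- S m) S-last ⟩
    sval s ℤ.- S m                      ∎
    where
    open ≡-Reasoning
    m+[K+1∸m]≡ = m+[K+1∸m] m m≤
    cancel : ∀ a t → a ℤ.+ t ℤ.- a ≡ t
    cancel = solve-∀

  ∈-toY : ∀ m → 1 ≤ m → m ≤ suc K → ∀ {w} → w ∈ toY m → w ≡ old y ⊎ IsNew w
  ∈-toY m 1≤m m≤ w∈ with ∈-segment m _ w∈
  ... | l , m≤l , l< , refl with l ℕP.≟ suc K
  ...   | yes refl = inj₁ p-last
  ...   | no l≢K+1 = inj₂ (p-inner-new l (ℕP.≤-trans 1≤m m≤l) (ℕ.s≤s⁻¹ (ℕP.≤∧≢⇒< l≤K+1 l≢K+1)))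
    where l≤K+1 = ℕ.s≤s⁻¹ (ℕP.≤-trans l< (ℕP.≤-reflexive (m+[K+2∸m] m m≤)))

  fromY : ℕ → List (Fin N)
  fromY m = reverse (segment m (suc K ℕ.∸ m))

  reverse-toY : ∀ m → m ≤ suc K → reverse (toY m) ≡ old y ∷ fromY m
  reverse-toY m m≤ =
    trans (cong reverse (segment-∷ʳ m (suc K ℕ.∸ m)))
      (trans (ListP.reverse-++ (segment m (suc K ℕ.∸ m)) [ p (m ℕ.+ (suc K ℕ.∸ m)) ])
             (cong (_∷ fromY m) (trans (cong p (m+[K+1∸m] m m≤)) p-last)))

  fromY-walk : ∀ m → m ≤ suc K → Walk G (old y) (p m) (old y ∷ fromY m)
  fromY-walk m m≤ = subst (Walk G (old y) (p m)) (reverse-toY m m≤) (walk-reverse G-sym (toY-walk m m≤))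

  fromY-sign : ∀ m → m ≤ suc K → walkSign τ (old y ∷ fromY m) ≡ sval s ℤ.- S m
  fromY-sign m m≤ = trans (cong (walkSign τ) (sym (reverse-toY m m≤)))
                          (trans (walkSign-reverse G-sym τ τ-sym (toY-walk m m≤)) (toY-sign m m≤))

  fromY-Unique : ∀ m → m ≤ suc K → Unique (fromY m)
  fromY-Unique m m≤ = Unique-tail (subst Unique (reverse-toY m m≤) (Unique-reverse (toY-Unique m m≤)))

  ∈-fromY : ∀ m → m ≤ suc K → ∀ {w} → w ∈ fromY m → ∃ λ l → m ≤ l × l ≤ K × w ≡ p l
  ∈-fromY m m≤ w∈ with ∈-segment m _ (AnyP.reverse⁻ w∈)
  ... | l , m≤l , l< , e = l , m≤l , ℕ.s≤s⁻¹ (ℕP.≤-trans l< (ℕP.≤-reflexive (m+[K+1∸m] m m≤))) , e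

  -- Zero-sign paths of G

  Exit : Fin N → Fin n → List (Fin N) → Set
  Exit u c D = Walk G u (old c) D × Unique D × (∀ {w} → w ∈ D → w ≡ old c ⊎ IsNew w)

  toX-exit : ∀ m → m ≤ K → Exit (p m) x (toX m)
  toX-exit m m≤K = toX-walk m (ℕP.m≤n⇒m≤1+n m≤K) , toX-Unique m (ℕP.m≤n⇒m≤1+n m≤K) , ∈-toX m m≤K

  toY-exit : ∀ m → 1 ≤ m → m ≤ suc K → Exit (p m) y (toY m)
  toY-exit m 1≤m m≤ = toY-walk m m≤ , toY-Unique m m≤ , ∈-toY m 1≤m m≤

  exit-then-lift : ∀ {u c a D r} → Exit u c D →
                   Walk G' c a (c ∷ r) → Unique (c ∷ r) → usesXY (c ∷ r) ≡ false →
                   walkSign τ D ℤ.+ walkSign σ' (c ∷ r) ≡ 0ℤ → ZeroPath G τ u (old a)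
  exit-then-lift {c = c} {D = D} {r} (W-D , u-D , ∈D) W u noXY sign≡0 =
    D ++ liftTail c r ,
    walk-++ W-D (lift-walk W) ,
    UniqueP.++⁺ u-D (Unique-tail (lift-Unique c r u)) disjoint ,
    trans (walkSign-++ τ (liftTail c r) W-D) (trans (cong (λ t → walkSign τ D ℤ.+ t) (lift-sign W)) sign≡0)
    where
    disjoint : Disjoint D (liftTail c r)
    disjoint (w∈D , w∈lift) with ∈-liftTail c r w∈lift | ∈D w∈D
    ... | inj₁ (c′ , c′∈r , refl) | inj₁ e = All.lookup (Unique-head u) c′∈r (old-injective (sym e))
    ... | inj₁ (_ , _ , refl) | inj₂ w-new = old-not-new w-new
    ... | inj₂ (_ , uses) | _ with () ← trans (sym noXY) uses

  -- If a zero-sign path from c starts with the edge cc′, leave through c′ instead and skip that edge.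
  exit-via-end : ∀ {u c c′ a D D′} → (c ≡ x × c′ ≡ y) ⊎ (c ≡ y × c′ ≡ x) →
                 Exit u c D → walkSign τ D ≡ 0ℤ → Exit u c′ D′ → walkSign τ D′ ≡ sval (σ' c c′) →
                 ZeroPath G' σ' c a → ZeroPath G τ u (old a)
  exit-via-end ends exit-c D≡0 exit-c′ D′≡cc′ (P , W , u-P , P≡0) with walk-head W
  ... | r , refl with usesXY (_ ∷ r) in uses
  ...   | false = exit-then-lift exit-c W u-P uses (trans (cong₂ ℤ._+_ D≡0 P≡0) refl)
  ...   | true with usesXY-from-end ends W u-P uses
  ...     | r′ , refl , noXY , W′ , u′ =
    exit-then-lift exit-c′ W′ u′ noXY (trans (cong (ℤ._+ _) D′≡cc′) P≡0)

  zeroPath-old-old : ∀ {a b} → ZeroPath G' σ' a b → ZeroPath G τ (old a) (old b)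
  zeroPath-old-old (P , W , u-P , P≡0) with walk-head W
  ... | r , refl = old _ ∷ liftTail _ r , lift-walk W , lift-Unique _ r u-P , trans (lift-sign W) P≡0

  zeroPath-inner-old : ∀ m a → 1 ≤ m → m ≤ K → ZeroPath G' σ' x a → ZeroPath G' σ' y a →
                       ZeroPath G τ (p m) (old a)
  zeroPath-inner-old m a 1≤m m≤K from-x from-y with S-values m
  ... | inj₁ (Sm≡0 , _) =
    exit-via-end (inj₁ (refl , refl))
      (toX-exit m m≤K) (trans (toX-sign m m≤) Sm≡0)
      (toY-exit m 1≤m m≤)
      (trans (toY-sign m m≤) (trans (cong (λ t → sval s ℤ.- t) Sm≡0) (ℤP.+-identityʳ _)))
      from-x
    where m≤ = ℕP.m≤n⇒m≤1+n m≤K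
  ... | inj₂ (Sm≡s , _) =
    exit-via-end (inj₂ (refl , refl))
      (toY-exit m 1≤m m≤)
      (trans (toY-sign m m≤) (trans (cong (λ t → sval s ℤ.- t) Sm≡s) (ℤP.+-inverseʳ (sval s))))
      (toX-exit m m≤K) (trans (toX-sign m m≤) (trans Sm≡s (cong sval (σ'-sym x y))))
      from-y
    where m≤ = ℕP.m≤n⇒m≤1+n m≤K

  along-path : ∀ {i j} → i ≤ j → j ≤ suc K → S i ≡ S j → ZeroPath G τ (p i) (p j)
  along-path {i} {j} i≤j j≤ Si≡Sj =
    subst (ZeroPath G τ (p i) ∘ p) i+d≡j
      ( segment i (suc d)
      , segment-walk i d i+d≤
      , segment-Unique i (suc d) (ℕP.≤-trans (ℕP.≤-reflexive (ℕP.+-suc i d)) (s≤s i+d≤))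
      , ∙-cancelˡ (S i) _ _ (trans (segment-sign i d i+d≤)
                                   (trans (cong S i+d≡j) (trans (sym Si≡Sj) (sym (ℤP.+-identityʳ _))))))
    where
    d = j ℕ.∸ i
    i+d≡j : i ℕ.+ d ≡ j
    i+d≡j = ℕP.m+[n∸m]≡n i≤j
    i+d≤ : i ℕ.+ d ≤ suc K
    i+d≤ = ℕP.≤-trans (ℕP.≤-reflexive i+d≡j) j≤

  Detour : ℤ → Set
  Detour z = ∃ λ r → Walk G' x y (x ∷ r) × Unique (x ∷ r) × usesXY (x ∷ r) ≡ false ×
                     walkSign σ' (x ∷ r) ≡ z

  xy-path-is-detour-or-edge : ∀ {r} → Walk G' x y (x ∷ r) → Unique (x ∷ r) →
                              usesXY (x ∷ r) ≡ false ⊎ r ≡ [ y ]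
  xy-path-is-detour-or-edge {r} W u with usesXY (x ∷ r) in uses
  ... | false = inj₁ refl
  ... | true with usesXY-from-end (inj₁ (refl , refl)) W u uses
  ...   | r′ , refl , _ , W′ , u′ with closed-walk-Unique W′ u′
  ...     | refl = inj₂ refl

  zero-detour : ZeroPath G' σ' x y → Detour 0ℤ
  zero-detour (P , W , u , P≡0) with walk-head W
  ... | r , refl with xy-path-is-detour-or-edge W u
  ...   | inj₁ noXY = r , W , u , noXY , P≡0
  ...   | inj₂ refl = ⊥-elim (sval+0≢0 s P≡0)
    where
    sval+0≢0 : ∀ t → sval t ℤ.+ 0ℤ ≢ 0ℤ
    sval+0≢0 Sign.+ ()
    sval+0≢0 Sign.- ()

  cycle-xy-path : ∀ C → IsCycle G' C → (x , y) ∈ cycleEdges C ⊎ (y , x) ∈ cycleEdges C →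
                  cycleSign σ' C ≡ - sval s →
                  ∃ λ Q → Walk G' x y Q × Unique Q × length Q ≡ length C × walkSign σ' Q ℤ.+ sval s ≡ - sval s
  cycle-xy-path C C-cycle (inj₁ xy∈) C≡-s with cycle-minus-edge σ' C C-cycle xy∈
  ... | Q , W , u , len , sign =
    reverse Q , walk-reverse (proj₁ G'-simple) W , Unique-reverse u , trans (ListP.length-reverse Q) len ,
    trans (cong (ℤ._+ sval s) (walkSign-reverse (proj₁ G'-simple) σ' σ'-sym W)) (trans sign C≡-s)
  cycle-xy-path C C-cycle (inj₂ yx∈) C≡-s with cycle-minus-edge σ' C C-cycle yx∈
  ... | Q , W , u , len , sign =
    Q , W , u , len , trans (cong (λ t → walkSign σ' Q ℤ.+ sval t) (σ'-sym x y)) (trans sign C≡-s)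

  cycle-detour : ∀ C → IsCycle G' C → (x , y) ∈ cycleEdges C ⊎ (y , x) ∈ cycleEdges C →
                 cycleSign σ' C ≡ - sval s → Detour (- sval s ℤ.- sval s)
  cycle-detour C C-cycle xy∈C C≡-s with cycle-xy-path C C-cycle xy∈C C≡-s
  ... | Q , W , u , len , sign with walk-head W
  ...   | r , refl with xy-path-is-detour-or-edge W u
  ...     | inj₁ noXY = r , W , u , noXY , trans (sym (cancel (walkSign σ' (x ∷ r)) (sval s))) (cong (ℤ._- sval s) sign)
    where
    cancel : ∀ a t → a ℤ.+ t ℤ.- t ≡ a
    cancel = solve-∀
  ...     | inj₂ refl with s≤s (s≤s ()) ← subst (3 ≤_) (sym len) (proj₁ C-cycle)

  -- S i, z and s − S j are the signs of the three legs p i ⋯ x, x ⋯ y and y ⋯ p j of through-detour.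
  balanced : ℤ → ℤ → ℤ → Set
  balanced z Si Sj = Si ℤ.+ (z ℤ.+ (sval s ℤ.- Sj)) ≡ 0ℤ

  through-detour : ∀ {i j z} → 1 ≤ i → i < j → j ≤ K → Detour z → balanced z (S i) (S j) →
                   ZeroPath G τ (p i) (p j)
  through-detour {i} {j} {z} 1≤i i<j j≤K (r , W , u , noXY , R≡z) sum≡0 =
    toX i ++ liftTail x r ++ fromY j ,
    walk-++ (toX-walk i i≤) (walk-++ (lift-walk W) (fromY-walk j j≤)) ,
    UniqueP.++⁺ (toX-Unique i i≤)
                (UniqueP.++⁺ (Unique-tail (lift-Unique x r u)) (fromY-Unique j j≤) lift#fromY) toX#rest ,
    sign
    where
    j≤ = ℕP.m≤n⇒m≤1+n j≤K
    i≤ = ℕP.≤-trans (ℕP.<⇒≤ i<j) j≤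
    ∈-lift : ∀ {w} → w ∈ liftTail x r → ∃ λ c → c ∈ r × w ≡ old c
    ∈-lift w∈ with ∈-liftTail x r w∈
    ... | inj₁ old-c = old-c
    ... | inj₂ (_ , uses) with () ← trans (sym noXY) uses
    fromY-new : ∀ {w} → w ∈ fromY j → IsNew w
    fromY-new w∈ with ∈-fromY j j≤ w∈
    ... | l , j≤l , l≤K , refl = p-inner-new l (ℕP.≤-trans 1≤i (ℕP.≤-trans (ℕP.<⇒≤ i<j) j≤l)) l≤K
    lift#fromY : Disjoint (liftTail x r) (fromY j)
    lift#fromY (w∈lift , w∈fromY) with ∈-lift w∈lift
    ... | _ , _ , refl = old-not-new (fromY-new w∈fromY)
    toX#rest : Disjoint (toX i) (liftTail x r ++ fromY j)
    toX#rest (w∈toX , w∈rest) with ∈-++⁻ (liftTail x r) w∈rest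
    ... | inj₁ w∈lift with ∈-lift w∈lift | ∈-toX i (ℕP.≤-trans (ℕP.<⇒≤ i<j) j≤K) w∈toX
    ...   | c , c∈r , refl | inj₁ e = All.lookup (Unique-head u) c∈r (sym (old-injective e))
    ...   | _ , _ , refl | inj₂ w-new = old-not-new w-new
    toX#rest (w∈toX , w∈rest) | inj₂ w∈fromY
      with ∈-segment 0 (suc i) (AnyP.reverse⁻ w∈toX) | ∈-fromY j j≤ w∈fromY
    ... | l , _ , l≤i , refl | l′ , j≤l′ , l′≤K , e
      with p-injective (ℕP.≤-trans (ℕ.s≤s⁻¹ l≤i) i≤) (ℕP.m≤n⇒m≤1+n l′≤K) e
    ...   | refl = ℕP.<-irrefl refl (ℕP.≤-trans (s≤s (ℕ.s≤s⁻¹ l≤i)) (ℕP.≤-trans i<j j≤l′))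
    open ≡-Reasoning
    sign : walkSign τ (toX i ++ liftTail x r ++ fromY j) ≡ 0ℤ
    sign = begin
      walkSign τ (toX i ++ liftTail x r ++ fromY j)
        ≡⟨ walkSign-++ τ _ (toX-walk i i≤) ⟩
      walkSign τ (toX i) ℤ.+ walkSign τ (old x ∷ liftTail x r ++ fromY j)
        ≡⟨ cong (λ t → walkSign τ (toX i) ℤ.+ t) (walkSign-++ τ (fromY j) (lift-walk W)) ⟩
      walkSign τ (toX i) ℤ.+ (walkSign τ (old x ∷ liftTail x r) ℤ.+ walkSign τ (old y ∷ fromY j))
        ≡⟨ cong₂ (λ a b → a ℤ.+ (b ℤ.+ walkSign τ (old y ∷ fromY j)))
                 (toX-sign i i≤) (trans (lift-sign W) R≡z) ⟩
      S i ℤ.+ (z ℤ.+ walkSign τ (old y ∷ fromY j))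
        ≡⟨ cong (λ t → S i ℤ.+ (z ℤ.+ t)) (fromY-sign j j≤) ⟩
      S i ℤ.+ (z ℤ.+ (sval s ℤ.- S j))
        ≡⟨ sum≡0 ⟩
      0ℤ
        ∎

  zeroPath-inner-inner : ∀ i j → 1 ≤ i → i < j → j ≤ K → Detour 0ℤ → Detour (- sval s ℤ.- sval s) →
                         ZeroPath G τ (p i) (p j)
  zeroPath-inner-inner i j 1≤i i<j j≤K detour₀ detour₋₂ with S-values i | S-values j
  ... | inj₁ (Si≡0 , _) | inj₁ (Sj≡0 , _) =
    along-path (ℕP.<⇒≤ i<j) (ℕP.m≤n⇒m≤1+n j≤K) (trans Si≡0 (sym Sj≡0))
  ... | inj₂ (Si≡s , _) | inj₂ (Sj≡s , _) =
    along-path (ℕP.<⇒≤ i<j) (ℕP.m≤n⇒m≤1+n j≤K) (trans Si≡s (sym Sj≡s))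
  ... | inj₁ (Si≡0 , _) | inj₂ (Sj≡s , _) =
    through-detour 1≤i i<j j≤K detour₀ (subst₂ (balanced 0ℤ) (sym Si≡0) (sym Sj≡s) (balance₀ (sval s)))
    where
    balance₀ : ∀ t → 0ℤ ℤ.+ (0ℤ ℤ.+ (t ℤ.- t)) ≡ 0ℤ
    balance₀ = solve-∀
  ... | inj₂ (Si≡s , _) | inj₁ (Sj≡0 , _) =
    through-detour 1≤i i<j j≤K detour₋₂
      (subst₂ (balanced (- sval s ℤ.- sval s)) (sym Si≡s) (sym Sj≡0) (balance₋₂ (sval s)))
    where
    balance₋₂ : ∀ t → t ℤ.+ ((- t ℤ.- t) ℤ.+ (t ℤ.- 0ℤ)) ≡ 0ℤ
    balance₋₂ = solve-∀

  module _ (zero′ : ∀ a b → ZeroPath G' σ' a b) (detour₋₂ : Detour (- sval s ℤ.- sval s)) where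

    zeroPath-new-old : ∀ i b → ZeroPath G τ (new i) (old b)
    zeroPath-new-old i b = subst (λ w → ZeroPath G τ w (old b)) (sym (new≡p i))
      (zeroPath-inner-old (suc (Fin.toℕ i)) b (s≤s z≤n) (FinP.toℕ<n i) (zero′ x b) (zero′ y b))

    zeroPath-new-new : ∀ {i j} → Fin.toℕ i < Fin.toℕ j → ZeroPath G τ (new i) (new j)
    zeroPath-new-new {i} {j} i<j = subst₂ (ZeroPath G τ) (sym (new≡p i)) (sym (new≡p j))
      (zeroPath-inner-inner _ _ (s≤s z≤n) (s≤s i<j) (FinP.toℕ<n j) (zero-detour (zero′ x y)) detour₋₂)

    zeroPath-everywhere : ∀ u v → ZeroPath G τ u v
    zeroPath-everywhere u v with old-or-new u | old-or-new v
    ... | inj₁ (a , refl) | inj₁ (b , refl) = zeroPath-old-old (zero′ a b)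
    ... | inj₂ (i , refl) | inj₁ (b , refl) = zeroPath-new-old i b
    ... | inj₁ (a , refl) | inj₂ (j , refl) = ZeroPath-sym G τ G-sym τ-sym (zeroPath-new-old j a)
    ... | inj₂ (i , refl) | inj₂ (j , refl) with ℕP.<-cmp (Fin.toℕ i) (Fin.toℕ j)
    ...   | tri< i<j _ _ = zeroPath-new-new i<j
    ...   | tri≈ _ i≡j _ rewrite FinP.toℕ-injective i≡j = ZeroPath-refl G τ (new j)
    ...   | tri> _ _ j<i = ZeroPath-sym G τ G-sym τ-sym (zeroPath-new-new j<i)

lemma3p5 : ∀ {n} (G' : Graph n) (σ' : Signing n) → IsSimple G' → IsSymmetric σ'
    → wiener G' σ' ≡ just 0
    → (x y : Fin n) → G' x y ≡ true
    → (C' : List (Fin n)) → IsCycle G' C'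
    → ((x , y) ∈ cycleEdges C' ⊎ (y , x) ∈ cycleEdges C')
    → cycleSign σ' C' ≡ - sval (σ' x y)
    → (k : ℕ) → Canceling (subdivide G' x y k)
lemma3p5 G' σ' G'-simple σ'-sym W≡0 x y xy∈G' C' C'-cycle xy∈C' C'≡-s k =
  τ , τ-sym , dist≡0⇒wiener≡0 G τ (λ u v → zeroPath⇒dist≡0 G τ (zeroPath-everywhere zero′ detour u v))
  where
  open Subdivision G' σ' G'-simple σ'-sym x y xy∈G' k
  zero′ : ∀ a b → ZeroPath G' σ' a b
  zero′ a b = dist≡0⇒zeroPath G' σ' (wiener≡0⇒dist≡0 G' σ' (proj₁ G'-simple) σ'-sym W≡0 a b)
  detour : Detour (- sval s ℤ.- sval s)
  detour = cycle-detour C' C'-cycle xy∈C' C'≡-s
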